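{- Let $(S,\{E_C\}_{C\subseteq N})$ be a finite frame in $\mathsf{Dev}(N)$ and let $X\subseteq S$ be an $E_N$-equivalence class, with the relations restricted to $X$. Then there exist sets $M_i$ ($i\in N$) and a bijection $h=(h_i)_{i\in N}:X\to\prod_{i\in N}M_i$ such that for all $s,t\in X$ and all $C\subseteq N$, $$sE_Ct\iff h_i(s)=h_i(t)\text{ for all }i\notin C,$$ if and only if $X$ satisfies coordinate separation: for all $s,t\in X$, if $sE_{N\setminus\{i\}}t$ for every $i\in N$, then $s=t$.
   Context: $N$ is a finite set of agents. $\mathsf{Dev}(N)$ is the class of frames $(S,\{E_C\}_{C\subseteq N})$ satisfying: (D1) each $E_C$ is an equivalence relation; (D2) $E_\emptyset$ is the identity on $S$; (D3) $C\subseteq D$ implies $E_C\subseteq E_D$; (D4) $E_C\circ E_D=E_{C\cup D}$ for all $C,D$, where $s(E_C\circ E_D)t$ iff there is $u$ with $sE_Cu$ and $uE_Dt$. -}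

module Defs where

open import Data.Nat using (ℕ)
open import Data.Fin using (Fin)
open import Data.Fin.Subset using (Subset; ⊤; ⊥; ⁅_⁆; ∁; _∪_; _⊆_; _∉_)
open import Data.Bool using (Bool; true)
open import Data.Product using (Σ; ∃; _×_)
open import Relation.Binary.PropositionalEquality using (_≡_)
open import Function.Bundles using (_⇔_)

-- A finite frame over agents Fin n with state space Fin m:
-- for every coalition C ⊆ N a (decidable, Bool-valued) relation E C on states.
-- "s E_C t" is  Rel E C s t.
Frame : ℕ → ℕ → Set
Frame n m = Subset n → Fin m → Fin m → Bool

Rel : ∀ {n m} → Frame n m → Subset n → Fin m → Fin m → Set
Rel E C s t = E C s t ≡ true

record IsDev {n m : ℕ} (E : Frame n m) : Set where
  field
    refl'  : ∀ C s → Rel E C s s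
    sym'   : ∀ C s t → Rel E C s t → Rel E C t s
    trans' : ∀ C s t u → Rel E C s t → Rel E C t u → Rel E C s u
    empty-id : ∀ s t → Rel E ⊥ s t ⇔ (s ≡ t)
    mono : ∀ C D → C ⊆ D → ∀ s t → Rel E C s t → Rel E D s t
    comp : ∀ C D s t → (∃ λ u → Rel E C s u × Rel E D u t) ⇔ Rel E (C ∪ D) s t

Class : ∀ {n m} → Frame n m → Fin m → Set
Class {m = m} E x0 = Σ (Fin m) (λ t → Rel E ⊤ x0 t)

IsProductBijection : ∀ {n} {X : Set} (M : Fin n → Set) → (X → (i : Fin n) → M i) → Set
IsProductBijection {n} {X} M h =
  (∀ s t → (∀ i → h s i ≡ h t i) → s ≡ t) ×
  (∀ (y : (i : Fin n) → M i) → ∃ λ s → ∀ i → h s i ≡ y i)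

CoordSep : ∀ {n m} → Frame n m → Fin m → Set
CoordSep {n} E x0 = ∀ (s t : Class E x0) →
  (∀ (i : Fin n) → Rel E (∁ ⁅ i ⁆) (Σ.proj₁ s) (Σ.proj₁ t)) → s ≡ t

ProductRep : ∀ {n m} → Frame n m → Fin m → Set₁
ProductRep {n} E x0 =
  Σ (Fin n → Set) λ M →
  Σ (Class E x0 → (i : Fin n) → M i) λ h →
    IsProductBijection M h ×
    (∀ (s t : Class E x0) (C : Subset n) →
       Rel E C (Σ.proj₁ s) (Σ.proj₁ t) ⇔ (∀ i → i ∉ C → h s i ≡ h t i))

{-# OPTIONS --safe #-}
module Submission where

open import Defs
open import Axiom.UniquenessOfIdentityProofs.WithK using (uip)
open import Data.Bool using (Bool; true; false)
open import Data.Bool.Properties using (⇔→≡)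
open import Data.Empty using (⊥-elim)
open import Data.Fin using (Fin; _≟_)
open import Data.Fin.Subset using (⊤; ⁅_⁆; ∁; _⊆_; _∈_; _∉_)
open import Data.Fin.Subset.Properties
  using (_∈?_; ⊆⊤; ∈⊤; x∈⁅x⁆; x∈⁅y⁆⇒x≡y; x≢y⇒x∉⁅y⁆; x∉p⇒x∈∁p; x∈p⇒x∉∁p; p∪∁p≡⊤)
open import Data.List using (List; []; _∷_; allFin; findᵇ)
open import Data.List.Membership.Propositional using () renaming (_∈_ to _∈ₗ_)
open import Data.List.Membership.Propositional.Properties using (∈-allFin)
open import Data.List.Relation.Unary.Any using (here; there)
open import Data.Maybe using (fromMaybe)
open import Data.Nat using (ℕ)
open import Data.Product using (Σ; ∃; _×_; _,_; proj₁; proj₂)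
open import Function.Base using (_∘_)
open import Function.Bundles using (_⇔_; mk⇔; Equivalence)
open import Relation.Binary.Structures using (IsEquivalence)
open import Relation.Binary.PropositionalEquality
  using (_≡_; refl; sym; trans; cong; subst)
open import Relation.Nullary using (yes; no)

-- Each coordinate i is the quotient of X by E_{N∖{i}}, realised by canonical
-- representatives.  Injectivity of h is coordinate separation.  For surjectivity,
-- and for recovering E_C from the coordinates outside C, one moves a state
-- towards given targets one agent j at a time: (D4) splits E_N as E_{j} ∘ E_{N∖{j}},
-- and the E_{j}-step towards the j-th target disturbs neither E_C (for j ∈ C) nor
-- the coordinates i ≠ j already fixed.  Conversely, a product representation
-- separates coordinates because E_{N∖{i}} preserves h_i.

module _ {a} {A : Set a} where

  fromMaybe-findᵇ-sound : ∀ (p : A → Bool) {d} xs →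
    p d ≡ true → p (fromMaybe d (findᵇ p xs)) ≡ true
  fromMaybe-findᵇ-sound p []       pd = pd
  fromMaybe-findᵇ-sound p (x ∷ xs) pd with p x in px
  ... | true  = px
  ... | false = fromMaybe-findᵇ-sound p xs pd

  fromMaybe-findᵇ-cong : ∀ {p q : A → Bool} {d e x xs} → (∀ y → p y ≡ q y) →
    x ∈ₗ xs → p x ≡ true → fromMaybe d (findᵇ p xs) ≡ fromMaybe e (findᵇ q xs)
  fromMaybe-findᵇ-cong {p} {q} {xs = y ∷ xs} p≗q x∈ px
    rewrite sym (p≗q y) with p y in py | x∈
  ... | true  | _          = refl
  ... | false | here refl  with () ← trans (sym py) px
  ... | false | there x∈xs = fromMaybe-findᵇ-cong p≗q x∈xs px

module Canonical {m} (R : Fin m → Fin m → Bool)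
                 (isEquivalence : IsEquivalence (λ s t → R s t ≡ true)) where
  open IsEquivalence isEquivalence
    renaming (refl to R-refl; sym to R-sym; trans to R-trans)

  -- The default s is never returned: s lies in its own class.
  canonical : Fin m → Fin m
  canonical s = fromMaybe s (findᵇ (R s) (allFin m))

  canonical-related : ∀ s → R s (canonical s) ≡ true
  canonical-related s = fromMaybe-findᵇ-sound (R s) (allFin m) R-refl

  canonical-≡⇔related : ∀ {s t} → canonical s ≡ canonical t ⇔ R s t ≡ true
  canonical-≡⇔related {s} {t} = mk⇔ to from
    where
    to : canonical s ≡ canonical t → R s t ≡ true
    to eq = R-trans (subst (λ u → R s u ≡ true) eq (canonical-related s))
                    (R-sym (canonical-related t))
    from : R s t ≡ true → canonical s ≡ canonical t
    from st = fromMaybe-findᵇ-cong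
      (λ u → ⇔→≡ (mk⇔ (R-trans (R-sym st)) (R-trans st)))
      (∈-allFin s) R-refl

  canonical-idempotent : ∀ s → canonical (canonical s) ≡ canonical s
  canonical-idempotent s =
    Equivalence.from canonical-≡⇔related (R-sym (canonical-related s))

x∈p⇒⁅x⁆⊆p : ∀ {n} {x : Fin n} {p} → x ∈ p → ⁅ x ⁆ ⊆ p
x∈p⇒⁅x⁆⊆p {p = p} x∈p y∈⁅x⁆ = subst (_∈ p) (sym (x∈⁅y⁆⇒x≡y _ y∈⁅x⁆)) x∈p

x∉p⇒p⊆∁⁅x⁆ : ∀ {n} {x : Fin n} {p} → x ∉ p → p ⊆ ∁ ⁅ x ⁆
x∉p⇒p⊆∁⁅x⁆ x∉p y∈p = x∉p⇒x∈∁p (λ y∈⁅x⁆ → x∉p (subst (_∈ _) (x∈⁅y⁆⇒x≡y _ y∈⁅x⁆) y∈p))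

module DevFrame {n m} {E : Frame n m} (dev : IsDev E) where
  open IsDev dev

  Rel⇒Rel⊤ : ∀ {C s t} → Rel E C s t → Rel E ⊤ s t
  Rel⇒Rel⊤ {C} = mono C ⊤ ⊆⊤ _ _

  Rel-isEquivalence : ∀ C → IsEquivalence (Rel E C)
  Rel-isEquivalence C = record
    { refl  = refl' C _
    ; sym   = sym' C _ _
    ; trans = trans' C _ _ _
    }

  Rel⊤-split : ∀ j {s t} → Rel E ⊤ s t → ∃ λ u → Rel E ⁅ j ⁆ s u × Rel E (∁ ⁅ j ⁆) u t
  Rel⊤-split j {s} {t} st = Equivalence.from (comp ⁅ j ⁆ (∁ ⁅ j ⁆) s t)
    (subst (λ C → Rel E C s t) (sym (p∪∁p≡⊤ ⁅ j ⁆)) st)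

  patch-along : ∀ C {s} (y : Fin n → Fin m) → (∀ i → Rel E ⊤ s (y i)) →
    (L : List (Fin n)) →
    ∃ λ w → Rel E C w s × (∀ i → i ∈ₗ L → i ∈ C → Rel E (∁ ⁅ i ⁆) w (y i))
  patch-along C {s} y sy [] = s , refl' C s , λ _ ()
  patch-along C {s} y sy (j ∷ L) with patch-along C y sy L | j ∈? C
  ... | w , wCs , wy | no j∉C = w , wCs , wy′
    where
    wy′ : ∀ i → i ∈ₗ j ∷ L → i ∈ C → Rel E (∁ ⁅ i ⁆) w (y i)
    wy′ i (here refl) j∈C = ⊥-elim (j∉C j∈C)
    wy′ i (there i∈L) i∈C = wy i i∈L i∈C
  ... | w , wCs , wy | yes j∈C
    with Rel⊤-split j (trans' ⊤ w s (y j) (Rel⇒Rel⊤ wCs) (sy j))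
  ...   | u , wu , uyj = u , uCs , uy
    where
    uw : Rel E ⁅ j ⁆ u w
    uw = sym' ⁅ j ⁆ w u wu
    uCs : Rel E C u s
    uCs = trans' C u w s (mono ⁅ j ⁆ C (x∈p⇒⁅x⁆⊆p j∈C) u w uw) wCs
    uy : ∀ i → i ∈ₗ j ∷ L → i ∈ C → Rel E (∁ ⁅ i ⁆) u (y i)
    uy i (here refl) _ = uyj
    uy i (there i∈L) i∈C with i ≟ j
    ... | yes refl = uyj
    ... | no i≢j   = trans' (∁ ⁅ i ⁆) u w (y i)
      (mono ⁅ j ⁆ (∁ ⁅ i ⁆) (x∉p⇒p⊆∁⁅x⁆ (x≢y⇒x∉⁅y⁆ i≢j)) u w uw) (wy i i∈L i∈C)

  patch : ∀ C {s} (y : Fin n → Fin m) → (∀ i → Rel E ⊤ s (y i)) →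
    ∃ λ w → Rel E C w s × (∀ i → i ∈ C → Rel E (∁ ⁅ i ⁆) w (y i))
  patch C y sy with patch-along C y sy (allFin n)
  ... | w , wCs , wy = w , wCs , λ i → wy i (∈-allFin i)

module ProductRepresentation {n m} {E : Frame n m} (dev : IsDev E) (x0 : Fin m) where
  open IsDev dev
  open DevFrame dev

  ∈X-closed : ∀ {C s t} → Rel E ⊤ x0 s → Rel E C s t → Rel E ⊤ x0 t
  ∈X-closed x0s st = trans' ⊤ x0 _ _ x0s (Rel⇒Rel⊤ st)

  coordSep⇒Rel⇔ : CoordSep E x0 → ∀ C (s t : Class E x0) →
    Rel E C (proj₁ s) (proj₁ t) ⇔ (∀ i → i ∉ C → Rel E (∁ ⁅ i ⁆) (proj₁ s) (proj₁ t))
  coordSep⇒Rel⇔ sep C (s , x0s) (t , x0t) = mk⇔ to from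
    where
    to : Rel E C s t → ∀ i → i ∉ C → Rel E (∁ ⁅ i ⁆) s t
    to st i i∉C = mono C (∁ ⁅ i ⁆) (x∉p⇒p⊆∁⁅x⁆ i∉C) s t st
    from : (∀ i → i ∉ C → Rel E (∁ ⁅ i ⁆) s t) → Rel E C s t
    from st with patch C (λ _ → t) (λ _ → trans' ⊤ s x0 t (sym' ⊤ x0 s x0s) x0t)
    ... | w , wCs , wt = sym' C t s (subst (λ u → Rel E C u s) w≡t wCs)
      where
      wt-all : ∀ i → Rel E (∁ ⁅ i ⁆) w t
      wt-all i with i ∈? C
      ... | yes i∈C = wt i i∈C
      ... | no i∉C  = trans' (∁ ⁅ i ⁆) w s t
        (mono C (∁ ⁅ i ⁆) (x∉p⇒p⊆∁⁅x⁆ i∉C) w s wCs) (st i i∉C)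
      w≡t : w ≡ t
      w≡t = cong proj₁ (sep (w , ∈X-closed x0s (sym' C w s wCs)) (t , x0t) wt-all)

  module Coordinate (i : Fin n) = Canonical (E (∁ ⁅ i ⁆)) (Rel-isEquivalence (∁ ⁅ i ⁆))
  open Coordinate using (canonical; canonical-related; canonical-≡⇔related; canonical-idempotent)

  M : Fin n → Set
  M i = Σ (Fin m) λ r → Rel E ⊤ x0 r × canonical i r ≡ r

  M-≡ : ∀ {i} {a b : M i} → proj₁ a ≡ proj₁ b → a ≡ b
  M-≡ {a = r , p , q} {b = .r , p′ , q′} refl rewrite uip p p′ | uip q q′ = refl

  h : Class E x0 → (i : Fin n) → M i
  h (s , x0s) i = canonical i s , ∈X-closed x0s (canonical-related i s) , canonical-idempotent i s

  h-≡⇔ : ∀ {s t : Class E x0} {i} → h s i ≡ h t i ⇔ Rel E (∁ ⁅ i ⁆) (proj₁ s) (proj₁ t)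
  h-≡⇔ {i = i} = mk⇔ (Equivalence.to (canonical-≡⇔related i) ∘ cong proj₁)
                     (M-≡ ∘ Equivalence.from (canonical-≡⇔related i))

  h-surjective : ∀ (y : (i : Fin n) → M i) → ∃ λ s → ∀ i → h s i ≡ y i
  h-surjective y with patch ⊤ (proj₁ ∘ y) (proj₁ ∘ proj₂ ∘ y)
  ... | w , wx0 , wy = (w , sym' ⊤ w x0 wx0) , λ i →
    M-≡ (trans (Equivalence.from (canonical-≡⇔related i) (wy i ∈⊤)) (proj₂ (proj₂ (y i))))

  coordSep⇒productRep : CoordSep E x0 → ProductRep E x0
  coordSep⇒productRep sep = M , h , (h-injective , h-surjective) , h-represents
    where
    h-injective : ∀ s t → (∀ i → h s i ≡ h t i) → s ≡ t
    h-injective s t eq = sep s t (Equivalence.to h-≡⇔ ∘ eq)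
    h-represents : ∀ (s t : Class E x0) C →
      Rel E C (proj₁ s) (proj₁ t) ⇔ (∀ i → i ∉ C → h s i ≡ h t i)
    h-represents s t C = mk⇔
      (λ st i i∉C → Equivalence.from h-≡⇔ (Equivalence.to (coordSep⇒Rel⇔ sep C s t) st i i∉C))
      (λ eq → Equivalence.from (coordSep⇒Rel⇔ sep C s t) (λ i i∉C → Equivalence.to h-≡⇔ (eq i i∉C)))

  productRep⇒coordSep : ProductRep E x0 → CoordSep E x0
  productRep⇒coordSep (_ , _ , (inj , _) , rel) s t st =
    inj s t (λ i → Equivalence.to (rel s t (∁ ⁅ i ⁆)) (st i) i (x∈p⇒x∉∁p (x∈⁅x⁆ i)))

proposition1 : ∀ (n m : ℕ) (E : Frame n m) → IsDev E → (x0 : Fin m) →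
    ProductRep E x0 ⇔ CoordSep E x0
proposition1 n m E dev x0 = mk⇔ productRep⇒coordSep coordSep⇒productRep
  where open ProductRepresentation dev x0
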